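{- Let $a=[a_0;a_1,\dots,a_{2\ell-1}]$ be the even-length continued fraction expansion of a positive rational number. The set of admissible sequences for $a$ satisfies \[ \left(\begin{array}{r} \sum_{b\in \mathcal{B}^\bullet(a)} q^{\Vert b\Vert_1}\\ \sum_{b\in \mathcal{B}^\circ(a)} q^{\Vert b\Vert_1} \end{array}\right) = \left(\begin{smallmatrix} 1 & 0 \\ 0 & q \end{smallmatrix}\right)^{ -1} R_q^{a_0}L_q^{a_1}\cdots R_q^{a_{2\ell-2}}L_q^{a_{2\ell-1}} \left(\begin{smallmatrix} 1 \\ 0 \end{smallmatrix}\right), \] where $\Vert b\Vert_1=b_0+b_1+\dots+b_{2\ell-1}$ for every admissible sequence $(b_i)_{0\le i<2\ell}\in\mathcal{B}(a)$.
   Context: Here $q$ is an indeterminate, $a_0\ge 0$ and $a_i\ge1$ for $1\le i<2\ell$, and $L_q=\left(\begin{smallmatrix} q & 0\\ q & 1\end{smallmatrix}\right)$, $R_q=\left(\begin{smallmatrix} q & 1\\ 0 & 1\end{smallmatrix}\right)$. A finite sequence of integers $(b_i)_{0\le i<k}$ is admissible for $a=[a_0;\dots,a_{k-1}]$ if: $0\le b_i\le a_i$ for all $i$; if $i>0$ is odd and $b_i=a_i$ then $b_{i-1}=a_{i-1}$; if $i>0$ is even and $b_i=0$ then $b_{i-1}=0$. $\mathcal{B}(a)$ is the set of admissible sequences for $a$, split as the disjoint union of $\mathcal{B}^\bullet(a)=\{b\in\mathcal{B}(a)\mid b_0=a_0=0<b_1=a_1 \text{ or } 0<b_0\}$ and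 $\mathcal{B}^\circ(a)=\{b\in\mathcal{B}(a)\mid b_0=a_0=0\le b_1<a_1 \text{ or } 0=b_0<a_0\}$. -}

module Defs where

open import Level using (0ℓ)
open import Data.Bool using (Bool; true; false; _∧_; _∨_; not; if_then_else_)
open import Data.Nat using (ℕ; zero; suc; _∸_; _≡ᵇ_; _<ᵇ_; _≤ᵇ_)
open import Data.Nat.Base using (_%_)
open import Data.List using (List; []; _∷_; length; map; concatMap; upTo; filter; foldr)
import Data.Nat as N

allᵇ : (ℕ → Bool) → List ℕ → Bool
allᵇ p []       = true
allᵇ p (x ∷ xs) = p x ∧ allᵇ p xs
open import Algebra.Bundles using (CommutativeSemiring)
open import Data.Product using (_×_; _,_; proj₁; proj₂)

-- Sequences a = [a₀; …, a_{k-1}] and b are lists of naturals, indexed from 0.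

-- i-th entry of a list (0 outside the range; only used for i < length).
at : List ℕ → ℕ → ℕ
at []       _       = 0
at (x ∷ xs) zero    = x
at (x ∷ xs) (suc i) = at xs i

_⇒ᵇ_ : Bool → Bool → Bool
p ⇒ᵇ q = not p ∨ q

isOdd : ℕ → Bool
isOdd i = (i % 2) ≡ᵇ 1

admissible : List ℕ → List ℕ → Bool
admissible a b =
  (length b ≡ᵇ length a)
  ∧ allᵇ (λ i → at b i ≤ᵇ at a i) (upTo (length a))
  ∧ allᵇ (λ i → (0 <ᵇ i) ⇒ᵇ
                 (if isOdd i
                  then ((at b i ≡ᵇ at a i) ⇒ᵇ (at b (i ∸ 1) ≡ᵇ at a (i ∸ 1)))
                  else ((at b i ≡ᵇ 0) ⇒ᵇ (at b (i ∸ 1) ≡ᵇ 0))))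
        (upTo (length a))

bullet : List ℕ → List ℕ → Bool
bullet a b =
  ((at b 0 ≡ᵇ 0) ∧ (at a 0 ≡ᵇ 0) ∧ (0 <ᵇ at b 1) ∧ (at b 1 ≡ᵇ at a 1))
  ∨ (0 <ᵇ at b 0)

circ : List ℕ → List ℕ → Bool
circ a b =
  ((at b 0 ≡ᵇ 0) ∧ (at a 0 ≡ᵇ 0) ∧ (at b 1 <ᵇ at a 1))
  ∨ ((at b 0 ≡ᵇ 0) ∧ (0 <ᵇ at a 0))

box : List ℕ → List (List ℕ)
box []       = [] ∷ []
box (x ∷ xs) = concatMap (λ c → map (c ∷_) (box xs)) (upTo (suc x))

-- 𝓑(a), 𝓑•(a), 𝓑∘(a) as duplicate-free lists
𝓑 : List ℕ → List (List ℕ)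
𝓑 a = Data.List.filter (λ b → Data.Bool._≟_ (admissible a b) true) (box a)
  where import Data.Bool

𝓑• : List ℕ → List (List ℕ)
𝓑• a = Data.List.filter (λ b → Data.Bool._≟_ (bullet a b) true) (𝓑 a)
  where import Data.Bool

𝓑∘ : List ℕ → List (List ℕ)
𝓑∘ a = Data.List.filter (λ b → Data.Bool._≟_ (circ a b) true) (𝓑 a)
  where import Data.Bool

norm1 : List ℕ → ℕ
norm1 = foldr N._+_ 0

-- Polynomial identities in the indeterminate q are stated by evaluating
-- at an arbitrary element q of an arbitrary commutative semiring
-- (universal property of ℕ[q]).

module Poly (S : CommutativeSemiring 0ℓ 0ℓ) where
  open CommutativeSemiring S

  pow : Carrier → ℕ → Carrier
  pow x zero    = 1#
  pow x (suc n) = x * pow x n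

  genSum : Carrier → List (List ℕ) → Carrier
  genSum q bs = foldr (λ b s → pow q (norm1 b) + s) 0# bs

  record Mat : Set where
    constructor mat
    field m11 m12 m21 m22 : Carrier
  open Mat public

  _⊗_ : Mat → Mat → Mat
  A ⊗ B = mat (m11 A * m11 B + m12 A * m21 B) (m11 A * m12 B + m12 A * m22 B)
              (m21 A * m11 B + m22 A * m21 B) (m21 A * m12 B + m22 A * m22 B)

  I₂ : Mat
  I₂ = mat 1# 0# 0# 1#

  matPow : Mat → ℕ → Mat
  matPow M zero    = I₂
  matPow M (suc n) = M ⊗ matPow M n

  Lq : Carrier → Mat
  Lq q = mat q 0# q 1#

  Rq : Carrier → Mat
  Rq q = mat q 1# 0# 1#

  mutual
    wordR : Carrier → List ℕ → Mat
    wordR q []       = I₂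
    wordR q (x ∷ xs) = matPow (Rq q) x ⊗ wordL q xs

    wordL : Carrier → List ℕ → Mat
    wordL q []       = I₂
    wordL q (x ∷ xs) = matPow (Lq q) x ⊗ wordR q xs

{-# OPTIONS --safe #-}
-- Write a = (x, y) ++ r and b = (u, v) ++ c. Then b is admissible for a iff (u, v) is admissible for
-- (x, y), c is admissible for r, and c₀ = 0 ⇒ v = 0. Hence the sums over 𝓑•(a) and 𝓑∘(a) are double
-- sums over u ≤ x, v ≤ y whose weights involve only F and F + G, the sums over the admissible tails c
-- with c₀ ≠ 0, resp. with any c₀. Raising a₀ by one shifts b₀, so the sum over 𝓑•(a₀+1, …) is q times
-- the sum over 𝓑(a) = 𝓑•(a) ⊔ 𝓑∘(a), while the sum over 𝓑∘ does not change: this is multiplication by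
-- R_q. For a₀ = 0, 𝓑• is b₁ = a₁ and 𝓑∘ is b₁ < a₁, which produces the first column of L_q^{a₁}.
-- Induction over the pairs of a finishes the proof, since for r = (a₂, a₃, …) with a₂ > 0 the tail
-- sums F and F + G are the sums over 𝓑•(r) and 𝓑(r).
module Submission where

open import Defs
open import Level using (0ℓ)
open import Data.Nat using (ℕ; zero; suc; z≤n; s≤s; _≤_; _<_; _≡ᵇ_; _<ᵇ_; _≤ᵇ_; _∸_)
import Data.Nat as N
open import Data.Nat.Properties using (≤⇒≤ᵇ; *-suc; suc-injective)
open import Data.Fin using (Fin; toℕ)
open import Data.Fin.Properties using (toℕ≤pred[n])
open import Data.List using (List; []; _∷_; _++_; length; map; concatMap; applyUpTo; upTo; filter; foldr)
open import Data.List.Properties using (foldr-map)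
open import Data.Bool using (Bool; true; false; _∧_; not; if_then_else_)
open import Data.Bool.Properties using (_≟_; T-≡; ∧-zeroʳ; ∧-identityʳ; ∨-zeroʳ; ∨-identityʳ; ∧-commutativeMonoid)
open import Data.Product using (_×_; _,_; proj₁; proj₂)
open import Function using (Equivalence)
open import Relation.Binary.PropositionalEquality using (_≡_)
import Relation.Binary.PropositionalEquality as ≡
open import Algebra.Bundles using (CommutativeSemiring)
import Algebra.Solver.CommutativeMonoid ∧-commutativeMonoid as ∧-Solver

pairRule : ℕ → ℕ → ℕ → ℕ → Bool
pairRule x y u v = (v ≡ᵇ y) ⇒ᵇ (u ≡ᵇ x)

-- The flag z stands for b₁ = 0, where c = (b₂, b₃, …) is the tail of b.
linked : List ℕ → List ℕ → Bool → Bool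
linked []      c z = true
linked (_ ∷ _) c z = (at c 0 ≡ᵇ 0) ⇒ᵇ z

entryBound : List ℕ → List ℕ → ℕ → Bool
entryBound a b i = at b i ≤ᵇ at a i

parityRule : List ℕ → List ℕ → ℕ → Bool
parityRule a b i = (0 <ᵇ i) ⇒ᵇ
                 (if isOdd i
                  then ((at b i ≡ᵇ at a i) ⇒ᵇ (at b (i ∸ 1) ≡ᵇ at a (i ∸ 1)))
                  else ((at b i ≡ᵇ 0) ⇒ᵇ (at b (i ∸ 1) ≡ᵇ 0)))

allᵇ-applyUpTo : ∀ {p p′ : ℕ → Bool} {f g : ℕ → ℕ} n → (∀ i → p (f i) ≡ p′ (g i)) →
  allᵇ p (applyUpTo f n) ≡ allᵇ p′ (applyUpTo g n)
allᵇ-applyUpTo zero    eq = ≡.refl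
allᵇ-applyUpTo (suc n) eq = ≡.cong₂ _∧_ (eq 0) (allᵇ-applyUpTo n (λ i → eq (suc i)))

admissible-∷∷ : ∀ x y r u v c → admissible (x ∷ y ∷ r) (u ∷ v ∷ c) ≡
  ((u ≤ᵇ x) ∧ (v ≤ᵇ y)) ∧ (pairRule x y u v ∧ (admissible r c ∧ linked r c (v ≡ᵇ 0)))
admissible-∷∷ x y r u v c = begin
  sameLength ∧ (((u ≤ᵇ x) ∧ ((v ≤ᵇ y) ∧ allᵇ (entryBound a b) rest)) ∧ (pairRule x y u v ∧ allᵇ (parityRule a b) rest))
    ≡⟨ ≡.cong₂ (λ bounds rules → sameLength ∧ (((u ≤ᵇ x) ∧ ((v ≤ᵇ y) ∧ bounds)) ∧ (pairRule x y u v ∧ rules)))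
               (allᵇ-applyUpTo (length r) (λ _ → ≡.refl)) (restRules r) ⟩
  sameLength ∧ (((u ≤ᵇ x) ∧ ((v ≤ᵇ y) ∧ bounds)) ∧ (pairRule x y u v ∧ (link ∧ rules)))
    ≡⟨ solve 7 (λ l bu bv bs p lk rs → l ⊕ ((bu ⊕ (bv ⊕ bs)) ⊕ (p ⊕ (lk ⊕ rs))) ⊜ (bu ⊕ bv) ⊕ (p ⊕ ((l ⊕ (bs ⊕ rs)) ⊕ lk)))
             ≡.refl sameLength (u ≤ᵇ x) (v ≤ᵇ y) bounds (pairRule x y u v) link rules ⟩
  ((u ≤ᵇ x) ∧ (v ≤ᵇ y)) ∧ (pairRule x y u v ∧ (admissible r c ∧ link)) ∎
  where
  open ≡.≡-Reasoning
  open ∧-Solver using (solve; _⊜_; _⊕_)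
  a = x ∷ y ∷ r
  b = u ∷ v ∷ c
  rest = applyUpTo (λ i → suc (suc i)) (length r)
  sameLength = length c ≡ᵇ length r
  bounds = allᵇ (entryBound r c) (upTo (length r))
  rules = allᵇ (parityRule r c) (upTo (length r))
  link = linked r c (v ≡ᵇ 0)
  restRules : ∀ r → allᵇ (parityRule (x ∷ y ∷ r) b) (applyUpTo (λ i → suc (suc i)) (length r))
                  ≡ linked r c (v ≡ᵇ 0) ∧ allᵇ (parityRule r c) (upTo (length r))
  restRules []      = ≡.refl
  restRules (_ ∷ r) = ≡.cong (linked (0 ∷ r) c (v ≡ᵇ 0) ∧_) (allᵇ-applyUpTo (length r) (λ _ → ≡.refl))

<ᵇ≡not≡ᵇ : ∀ {m n} → m ≤ n → (m <ᵇ n) ≡ not (m ≡ᵇ n)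
<ᵇ≡not≡ᵇ {n = zero}  z≤n     = ≡.refl
<ᵇ≡not≡ᵇ {n = suc n} z≤n     = ≡.refl
<ᵇ≡not≡ᵇ             (s≤s p) = <ᵇ≡not≡ᵇ p

bulletPair circPair : ℕ → ℕ → ℕ → ℕ → Bool
bulletPair x y u v = pairRule x y u v ∧ bullet (x ∷ y ∷ []) (u ∷ v ∷ [])
circPair   x y u v = pairRule x y u v ∧ circ (x ∷ y ∷ []) (u ∷ v ∷ [])

data PositivePairs : List ℕ → Set where
  []   : PositivePairs []
  pair : ∀ x y {r} → PositivePairs r → PositivePairs (suc x ∷ suc y ∷ r)

data EvenExpansion : List ℕ → Set where
  expansion : ∀ x y {r} → PositivePairs r → EvenExpansion (x ∷ suc y ∷ r)

module GeneratingSums (S : CommutativeSemiring 0ℓ 0ℓ) (q : CommutativeSemiring.Carrier S) where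
  open CommutativeSemiring S
  open Poly S
  open import Algebra.Properties.Semiring.Sum semiring
    using (sum-syntax; sum⁺-syntax; sum-cong-≋; sum-replicate-zero; *-distribˡ-sum; *-distribʳ-sum; ∑-distrib-+)
  open import Algebra.Solver.Ring.NaturalCoefficients.Default S
  open import Relation.Binary.Reasoning.Setoid setoid

  sumOver : {A : Set} → List A → (A → Carrier) → Carrier
  sumOver xs f = foldr (λ b s → f b + s) 0# xs

  infixl 10 sumOver
  syntax sumOver xs (λ b → e) = ∑[ b ∈ xs ] e

  𝟙 : Bool → Carrier
  𝟙 true  = 1#
  𝟙 false = 0#

  𝟙-∧ : ∀ A B → 𝟙 (A ∧ B) ≈ 𝟙 A * 𝟙 B
  𝟙-∧ true  B = sym (*-identityˡ (𝟙 B))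
  𝟙-∧ false B = sym (zeroˡ (𝟙 B))

  pow-+ : ∀ m n → pow q (m N.+ n) ≈ pow q m * pow q n
  pow-+ zero    n = sym (*-identityˡ (pow q n))
  pow-+ (suc m) n = trans (*-congˡ (pow-+ m n)) (sym (*-assoc q (pow q m) (pow q n)))

  sumOver-cong : ∀ {A : Set} (xs : List A) {f g : A → Carrier} → (∀ b → f b ≈ g b) → sumOver xs f ≈ sumOver xs g
  sumOver-cong []       eq = refl
  sumOver-cong (x ∷ xs) eq = +-cong (eq x) (sumOver-cong xs eq)

  sumOver-++ : ∀ {A : Set} (xs ys : List A) (f : A → Carrier) → sumOver (xs ++ ys) f ≈ sumOver xs f + sumOver ys f
  sumOver-++ []       ys f = sym (+-identityˡ (sumOver ys f))
  sumOver-++ (x ∷ xs) ys f = trans (+-congˡ (sumOver-++ xs ys f)) (sym (+-assoc (f x) _ _))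

  sumOver-concatMap : ∀ {A B : Set} (g : A → List B) xs (f : B → Carrier) →
    sumOver (concatMap g xs) f ≈ ∑[ a ∈ xs ] sumOver (g a) f
  sumOver-concatMap g []       f = refl
  sumOver-concatMap g (x ∷ xs) f = trans (sumOver-++ (g x) (concatMap g xs) f) (+-congˡ (sumOver-concatMap g xs f))

  sumOver-applyUpTo : ∀ (g : ℕ → ℕ) n (f : ℕ → Carrier) → sumOver (applyUpTo g n) f ≡ ∑[ i < n ] f (g (toℕ i))
  sumOver-applyUpTo g zero    f = ≡.refl
  sumOver-applyUpTo g (suc n) f = ≡.cong (f (g 0) +_) (sumOver-applyUpTo (λ i → g (suc i)) n f)

  *-distribˡ-sumOver : ∀ {A : Set} c (xs : List A) (f : A → Carrier) → c * sumOver xs f ≈ ∑[ b ∈ xs ] (c * f b)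
  *-distribˡ-sumOver c []       f = zeroʳ c
  *-distribˡ-sumOver c (x ∷ xs) f = trans (distribˡ c (f x) _) (+-congˡ (*-distribˡ-sumOver c xs f))

  sumOver-filter : ∀ {A : Set} (P : A → Bool) xs (f : A → Carrier) →
    sumOver (filter (λ b → P b ≟ true) xs) f ≈ ∑[ b ∈ xs ] (𝟙 (P b) * f b)
  sumOver-filter P []       f = refl
  sumOver-filter P (x ∷ xs) f with P x
  ... | true  = +-cong (sym (*-identityˡ (f x))) (sumOver-filter P xs f)
  ... | false = trans (sumOver-filter P xs f) (sym (trans (+-congʳ (zeroˡ (f x))) (+-identityˡ _)))

  sumOver-box : ∀ x a (f : List ℕ → Carrier) → sumOver (box (x ∷ a)) f ≈ ∑[ i ≤ x ] ∑[ c ∈ box a ] f (toℕ i ∷ c)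
  sumOver-box x a f = begin
    sumOver (concatMap (λ u → map (u ∷_) (box a)) (upTo (suc x))) f
      ≈⟨ sumOver-concatMap (λ u → map (u ∷_) (box a)) (upTo (suc x)) f ⟩
    ∑[ u ∈ upTo (suc x) ] sumOver (map (u ∷_) (box a)) f
      ≈⟨ sumOver-cong (upTo (suc x)) (λ u → reflexive (foldr-map _ (u ∷_) 0# (box a))) ⟩
    ∑[ u ∈ upTo (suc x) ] ∑[ c ∈ box a ] f (u ∷ c)
      ≡⟨ sumOver-applyUpTo (λ u → u) (suc x) _ ⟩
    ∑[ i ≤ x ] ∑[ c ∈ box a ] f (toℕ i ∷ c) ∎

  ∑-pow-suc : ∀ n (f : ℕ → Carrier) →
    ∑[ j < suc n ] (pow q (toℕ j) * f (toℕ j)) ≈ f 0 + q * ∑[ j < n ] (pow q (toℕ j) * f (suc (toℕ j)))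
  ∑-pow-suc n f = +-cong (*-identityˡ (f 0)) (begin
    ∑[ j < n ] (q * pow q (toℕ j) * f (suc (toℕ j)))     ≈⟨ sum-cong-≋ {n} (λ j → *-assoc q (pow q (toℕ j)) (f (suc (toℕ j)))) ⟩
    ∑[ j < n ] (q * (pow q (toℕ j) * f (suc (toℕ j))))   ≈⟨ *-distribˡ-sum {n} q (λ j → pow q (toℕ j) * f (suc (toℕ j))) ⟨
    q * ∑[ j < n ] (pow q (toℕ j) * f (suc (toℕ j)))     ∎)

  ∑-pow-≡ᵇ : ∀ n → ∑[ j ≤ n ] (pow q (toℕ j) * 𝟙 (toℕ j ≡ᵇ n)) ≈ pow q n
  ∑-pow-≡ᵇ zero    = solve 0 (con 1 :* con 1 :+ con 0 := con 1) refl
  ∑-pow-≡ᵇ (suc n) = trans (∑-pow-suc (suc n) (λ v → 𝟙 (v ≡ᵇ suc n)))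
                           (trans (+-identityˡ _) (*-congˡ (∑-pow-≡ᵇ n)))

  [_]q : ℕ → Carrier
  [ zero  ]q = 0#
  [ suc n ]q = 1# + q * [ n ]q

  [suc]q-snoc : ∀ n → [ suc n ]q ≈ [ n ]q + pow q n
  [suc]q-snoc zero    = solve 1 (λ q → con 1 :+ q :* con 0 := con 0 :+ con 1) refl q
  [suc]q-snoc (suc n) = begin
    1# + q * [ suc n ]q           ≈⟨ +-congˡ (*-congˡ ([suc]q-snoc n)) ⟩
    1# + q * ([ n ]q + pow q n)   ≈⟨ solve 3 (λ q g p → con 1 :+ q :* (g :+ p) := (con 1 :+ q :* g) :+ q :* p) refl q [ n ]q (pow q n) ⟩
    [ suc n ]q + pow q (suc n)    ∎

  ∑-pow-≢ᵇ : ∀ n → ∑[ j ≤ n ] (pow q (toℕ j) * 𝟙 (not (toℕ j ≡ᵇ n))) ≈ [ n ]q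
  ∑-pow-≢ᵇ zero    = solve 0 (con 1 :* con 0 :+ con 0 := con 0) refl
  ∑-pow-≢ᵇ (suc n) = trans (∑-pow-suc (suc n) (λ v → 𝟙 (not (v ≡ᵇ suc n)))) (+-congˡ (*-congˡ (∑-pow-≢ᵇ n)))

  weight : List ℕ → (List ℕ → Bool) → List ℕ → Carrier
  weight a E b = 𝟙 (admissible a b ∧ E b) * pow q (norm1 b)

  admissibleSum : List ℕ → (List ℕ → Bool) → Carrier
  admissibleSum a E = ∑[ b ∈ box a ] weight a E b

  ∑𝓑 ∑𝓑• ∑𝓑∘ : List ℕ → Carrier
  ∑𝓑  a = admissibleSum a (λ _ → true)
  ∑𝓑• a = admissibleSum a (bullet a)
  ∑𝓑∘ a = admissibleSum a (circ a)

  tailSum : List ℕ → Bool → Carrier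
  tailSum r z = admissibleSum r (λ c → linked r c z)

  admissibleSum-cong : ∀ a {E E′ : List ℕ → Bool} → (∀ b → E b ≡ E′ b) → admissibleSum a E ≈ admissibleSum a E′
  admissibleSum-cong a eq = sumOver-cong (box a) (λ b → reflexive (≡.cong (λ e → 𝟙 (admissible a b ∧ e) * pow q (norm1 b)) (eq b)))

  genSum-filter-𝓑 : ∀ a (E : List ℕ → Bool) → genSum q (filter (λ b → E b ≟ true) (𝓑 a)) ≈ admissibleSum a E
  genSum-filter-𝓑 a E = begin
    genSum q (filter (λ b → E b ≟ true) (𝓑 a))
      ≈⟨ sumOver-filter E (𝓑 a) (λ b → pow q (norm1 b)) ⟩
    ∑[ b ∈ 𝓑 a ] (𝟙 (E b) * pow q (norm1 b))
      ≈⟨ sumOver-filter (admissible a) (box a) _ ⟩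
    ∑[ b ∈ box a ] (𝟙 (admissible a b) * (𝟙 (E b) * pow q (norm1 b)))
      ≈⟨ sumOver-cong (box a) (λ b → trans (sym (*-assoc _ _ _)) (*-congʳ (sym (𝟙-∧ (admissible a b) (E b))))) ⟩
    admissibleSum a E ∎

  weight-∷∷ : ∀ {x y u v} r (E : List ℕ → Bool) → (∀ c → E (u ∷ v ∷ c) ≡ E (u ∷ v ∷ [])) → u ≤ x → v ≤ y → ∀ c →
    weight (x ∷ y ∷ r) E (u ∷ v ∷ c)
      ≈ pow q u * (pow q v * (𝟙 (pairRule x y u v ∧ E (u ∷ v ∷ [])) * weight r (λ c → linked r c (v ≡ᵇ 0)) c))
  weight-∷∷ {x} {y} {u} {v} r E E≡e u≤x v≤y c = begin
    weight (x ∷ y ∷ r) E (u ∷ v ∷ c)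
      ≡⟨ ≡.cong₂ (λ A B → 𝟙 (A ∧ B) * pow q (u N.+ (v N.+ norm1 c)))
                 (≡.trans (admissible-∷∷ x y r u v c) (≡.cong₂ (λ s t → (s ∧ t) ∧ (P ∧ T)) (≤ᵇ-true u≤x) (≤ᵇ-true v≤y)))
                 (E≡e c) ⟩
    𝟙 ((P ∧ T) ∧ e) * pow q (u N.+ (v N.+ norm1 c))
      ≈⟨ *-cong (trans (𝟙-∧ (P ∧ T) e) (*-congʳ (𝟙-∧ P T)))
                (trans (pow-+ u (v N.+ norm1 c)) (*-congˡ (pow-+ v (norm1 c)))) ⟩
    𝟙 P * 𝟙 T * 𝟙 e * (pow q u * (pow q v * pow q (norm1 c)))
      ≈⟨ solve 6 (λ p t e pu pv pc → p :* t :* e :* (pu :* (pv :* pc)) := pu :* (pv :* (p :* e :* (t :* pc))))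
               refl (𝟙 P) (𝟙 T) (𝟙 e) (pow q u) (pow q v) (pow q (norm1 c)) ⟩
    pow q u * (pow q v * (𝟙 P * 𝟙 e * (𝟙 T * pow q (norm1 c))))
      ≈⟨ *-congˡ (*-congˡ (*-congʳ (𝟙-∧ P e))) ⟨
    pow q u * (pow q v * (𝟙 (P ∧ e) * (𝟙 T * pow q (norm1 c)))) ∎
    where
    P = pairRule x y u v
    T = admissible r c ∧ linked r c (v ≡ᵇ 0)
    e = E (u ∷ v ∷ [])
    ≤ᵇ-true : ∀ {m n} → m ≤ n → (m ≤ᵇ n) ≡ true
    ≤ᵇ-true m≤n = Equivalence.to T-≡ (≤⇒≤ᵇ m≤n)

  module _ (r : List ℕ) where

    -- b₀ = u ≤ x and b₁ = v ≤ y; which tails may follow depends only on whether v = 0.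
    rowSum : ℕ → (ℕ → Bool) → Carrier
    rowSum y ψ = ∑[ j ≤ y ] (pow q (toℕ j) * (𝟙 (ψ (toℕ j)) * tailSum r (toℕ j ≡ᵇ 0)))

    gridSum : ℕ → ℕ → (ℕ → ℕ → Bool) → Carrier
    gridSum x y φ = ∑[ i ≤ x ] (pow q (toℕ i) * rowSum y (φ (toℕ i)))

    admissibleSum-∷∷ : ∀ x y (E : List ℕ → Bool) → (∀ u v c → E (u ∷ v ∷ c) ≡ E (u ∷ v ∷ [])) →
      admissibleSum (x ∷ y ∷ r) E ≈ gridSum x y (λ u v → pairRule x y u v ∧ E (u ∷ v ∷ []))
    admissibleSum-∷∷ x y E E≡e = begin
      admissibleSum (x ∷ y ∷ r) E
        ≈⟨ sumOver-box x (y ∷ r) (weight a E) ⟩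
      ∑[ i ≤ x ] ∑[ b ∈ box (y ∷ r) ] weight a E (toℕ i ∷ b)
        ≈⟨ sum-cong-≋ {suc x} (λ i → sumOver-box y r (λ b → weight a E (toℕ i ∷ b))) ⟩
      ∑[ i ≤ x ] ∑[ j ≤ y ] ∑[ c ∈ box r ] weight a E (toℕ i ∷ toℕ j ∷ c)
        ≈⟨ sum-cong-≋ {suc x} (λ i → sum-cong-≋ {suc y} (λ j → sumOver-cong (box r)
             (weight-∷∷ r E (E≡e (toℕ i) (toℕ j)) (toℕ≤pred[n] i) (toℕ≤pred[n] j)))) ⟩
      ∑[ i ≤ x ] ∑[ j ≤ y ] ∑[ c ∈ box r ] (pow q (toℕ i) * (pow q (toℕ j) * (𝟙 (φ (toℕ i) (toℕ j)) * t (toℕ j) c)))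
        ≈⟨ sum-cong-≋ {suc x} (λ i → sum-cong-≋ {suc y} (λ j → factor (toℕ i) (toℕ j))) ⟨
      ∑[ i ≤ x ] ∑[ j ≤ y ] (pow q (toℕ i) * (pow q (toℕ j) * (𝟙 (φ (toℕ i) (toℕ j)) * tailSum r (toℕ j ≡ᵇ 0))))
        ≈⟨ sum-cong-≋ {suc x} (λ i → *-distribˡ-sum {suc y} (pow q (toℕ i)) (λ j → pow q (toℕ j) * (𝟙 (φ (toℕ i) (toℕ j)) * tailSum r (toℕ j ≡ᵇ 0)))) ⟨
      gridSum x y φ ∎
      where
      a = x ∷ y ∷ r
      φ : ℕ → ℕ → Bool
      φ u v = pairRule x y u v ∧ E (u ∷ v ∷ [])
      t : ℕ → List ℕ → Carrier
      t v = weight r (λ c → linked r c (v ≡ᵇ 0))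
      factor : ∀ u v → pow q u * (pow q v * (𝟙 (φ u v) * tailSum r (v ≡ᵇ 0)))
                       ≈ ∑[ c ∈ box r ] (pow q u * (pow q v * (𝟙 (φ u v) * t v c)))
      factor u v = trans (*-congˡ (*-congˡ (*-distribˡ-sumOver (𝟙 (φ u v)) (box r) (t v))))
                   (trans (*-congˡ (*-distribˡ-sumOver (pow q v) (box r) _))
                          (*-distribˡ-sumOver (pow q u) (box r) _))

    rowSum-cong : ∀ y (ψ ψ′ : ℕ → Bool) → (∀ v → v ≤ y → ψ v ≡ ψ′ v) → rowSum y ψ ≈ rowSum y ψ′
    rowSum-cong y ψ ψ′ eq = sum-cong-≋ {suc y} (λ j → reflexive
      (≡.cong (λ b → pow q (toℕ j) * (𝟙 b * tailSum r (toℕ j ≡ᵇ 0))) (eq (toℕ j) (toℕ≤pred[n] j))))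

    rowSum-false : ∀ y (ψ : ℕ → Bool) → (∀ v → ψ v ≡ false) → rowSum y ψ ≈ 0#
    rowSum-false y ψ ψ≡false = trans (sum-cong-≋ {suc y} zero-term) (sum-replicate-zero (suc y))
      where
      zero-term : ∀ j → pow q (toℕ j) * (𝟙 (ψ (toℕ j)) * tailSum r (toℕ j ≡ᵇ 0)) ≈ 0#
      zero-term j rewrite ψ≡false (toℕ j) = trans (*-congˡ (zeroˡ _)) (zeroʳ _)

    gridSum-false : ∀ x y (φ : ℕ → ℕ → Bool) → (∀ u v → φ u v ≡ false) → gridSum x y φ ≈ 0#
    gridSum-false x y φ φ≡false = trans (sum-cong-≋ {suc x} zero-row) (sum-replicate-zero (suc x))
      where
      zero-row : ∀ i → pow q (toℕ i) * rowSum y (φ (toℕ i)) ≈ 0#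
      zero-row i = trans (*-congˡ (rowSum-false y (φ (toℕ i)) (φ≡false (toℕ i)))) (zeroʳ _)

    gridSum-zero : ∀ y φ → gridSum 0 y φ ≈ rowSum y (φ 0)
    gridSum-zero y φ = trans (+-identityʳ _) (*-identityˡ _)

    gridSum-suc : ∀ x y φ → gridSum (suc x) y φ ≈ rowSum y (φ 0) + q * gridSum x y (λ u → φ (suc u))
    gridSum-suc x y φ = ∑-pow-suc (suc x) (λ u → rowSum y (φ u))

    rowSum-suc : ∀ y ψ → rowSum (suc y) ψ ≈
      𝟙 (ψ 0) * tailSum r true + q * ∑[ j ≤ y ] (pow q (toℕ j) * 𝟙 (ψ (suc (toℕ j)))) * tailSum r false
    rowSum-suc y ψ = trans (∑-pow-suc (suc y) (λ v → 𝟙 (ψ v) * tailSum r (v ≡ᵇ 0))) (+-congˡ (begin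
      q * ∑[ j ≤ y ] (pow q (toℕ j) * (𝟙 (ψ′ j) * k₀))   ≈⟨ *-congˡ (sum-cong-≋ {suc y} (λ j → *-assoc (pow q (toℕ j)) (𝟙 (ψ′ j)) k₀)) ⟨
      q * ∑[ j ≤ y ] (pow q (toℕ j) * 𝟙 (ψ′ j) * k₀)     ≈⟨ *-congˡ (*-distribʳ-sum {suc y} k₀ (λ j → pow q (toℕ j) * 𝟙 (ψ′ j))) ⟨
      q * (∑[ j ≤ y ] (pow q (toℕ j) * 𝟙 (ψ′ j)) * k₀)   ≈⟨ *-assoc q _ k₀ ⟨
      q * ∑[ j ≤ y ] (pow q (toℕ j) * 𝟙 (ψ′ j)) * k₀     ∎))
      where
      k₀ = tailSum r false
      ψ′ = λ j → ψ (suc (toℕ j))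

    rowSum-partition : ∀ y (ψ : ℕ → Bool) → rowSum y ψ + rowSum y (λ v → not (ψ v)) ≈ rowSum y (λ _ → true)
    rowSum-partition y ψ = trans (sym (∑-distrib-+ {suc y} (term ψ) (term (λ v → not (ψ v)))))
                              (sum-cong-≋ {suc y} (λ j → split {pow q (toℕ j)} {tailSum r (toℕ j ≡ᵇ 0)} (ψ (toℕ j))))
      where
      term : (ℕ → Bool) → Fin (suc y) → Carrier
      term χ j = pow q (toℕ j) * (𝟙 (χ (toℕ j)) * tailSum r (toℕ j ≡ᵇ 0))
      split : ∀ {p k} b → p * (𝟙 b * k) + p * (𝟙 (not b) * k) ≈ p * (1# * k)
      split {p} {k} true  = solve 2 (λ p k → p :* (con 1 :* k) :+ p :* (con 0 :* k) := p :* (con 1 :* k)) refl p k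
      split {p} {k} false = solve 2 (λ p k → p :* (con 0 :* k) :+ p :* (con 1 :* k) := p :* (con 1 :* k)) refl p k

    rowSum-≡ᵇ : ∀ y → rowSum (suc y) (λ v → v ≡ᵇ suc y) ≈ pow q (suc y) * tailSum r false
    rowSum-≡ᵇ y = begin
      rowSum (suc y) (λ v → v ≡ᵇ suc y)
        ≈⟨ rowSum-suc y (λ v → v ≡ᵇ suc y) ⟩
      0# * tailSum r true + q * ∑[ j ≤ y ] (pow q (toℕ j) * 𝟙 (toℕ j ≡ᵇ y)) * tailSum r false
        ≈⟨ +-cong (zeroˡ _) (*-congʳ (*-congˡ (∑-pow-≡ᵇ y))) ⟩
      0# + pow q (suc y) * tailSum r false
        ≈⟨ +-identityˡ _ ⟩
      pow q (suc y) * tailSum r false ∎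

    rowSum-≢ᵇ : ∀ y → rowSum (suc y) (λ v → not (v ≡ᵇ suc y)) ≈ tailSum r true + q * [ y ]q * tailSum r false
    rowSum-≢ᵇ y = trans (rowSum-suc y (λ v → not (v ≡ᵇ suc y)))
                     (+-cong (*-identityˡ _) (*-congʳ (*-congˡ (∑-pow-≢ᵇ y))))

    ∑𝓑-gridSum : ∀ x y → ∑𝓑 (x ∷ y ∷ r) ≈ gridSum x y (λ u v → pairRule x y u v ∧ true)
    ∑𝓑-gridSum x y = admissibleSum-∷∷ x y (λ _ → true) (λ _ _ _ → ≡.refl)

    ∑𝓑•-gridSum : ∀ x y → ∑𝓑• (x ∷ y ∷ r) ≈ gridSum x y (bulletPair x y)
    ∑𝓑•-gridSum x y = admissibleSum-∷∷ x y (bullet (x ∷ y ∷ r)) (λ _ _ _ → ≡.refl)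

    ∑𝓑∘-gridSum : ∀ x y → ∑𝓑∘ (x ∷ y ∷ r) ≈ gridSum x y (circPair x y)
    ∑𝓑∘-gridSum x y = admissibleSum-∷∷ x y (circ (x ∷ y ∷ r)) (λ _ _ _ → ≡.refl)

    ∑𝓑∘-∷∷ : ∀ x y → ∑𝓑∘ (x ∷ suc y ∷ r) ≈ rowSum (suc y) (λ v → not (v ≡ᵇ suc y))
    ∑𝓑∘-∷∷ zero    y = begin
      ∑𝓑∘ (0 ∷ suc y ∷ r)                           ≈⟨ trans (∑𝓑∘-gridSum 0 (suc y)) (gridSum-zero (suc y) (circPair 0 (suc y))) ⟩
      rowSum (suc y) (circPair 0 (suc y) 0)           ≈⟨ rowSum-cong (suc y) _ _ below-top ⟩
      rowSum (suc y) (λ v → not (v ≡ᵇ suc y))          ∎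
      where
      below-top : ∀ v → v ≤ suc y → circPair 0 (suc y) 0 v ≡ not (v ≡ᵇ suc y)
      below-top v v≤y rewrite ∨-zeroʳ (not (v ≡ᵇ suc y)) | ∨-identityʳ (v <ᵇ suc y) = <ᵇ≡not≡ᵇ v≤y
    ∑𝓑∘-∷∷ (suc x) y = begin
      ∑𝓑∘ (suc x ∷ suc y ∷ r)
        ≈⟨ trans (∑𝓑∘-gridSum (suc x) (suc y)) (gridSum-suc x (suc y) (circPair (suc x) (suc y))) ⟩
      rowSum (suc y) (circPair (suc x) (suc y) 0) + q * gridSum x (suc y) (λ u → circPair (suc x) (suc y) (suc u))
        ≈⟨ +-cong (rowSum-cong (suc y) (circPair (suc x) (suc y) 0) _ (λ v _ → ≡.trans (∧-identityʳ _) (∨-identityʳ _)))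
                  (*-congˡ (gridSum-false x (suc y) (λ u → circPair (suc x) (suc y) (suc u)) (λ u v → ∧-zeroʳ _))) ⟩
      rowSum (suc y) (λ v → not (v ≡ᵇ suc y)) + q * 0#
        ≈⟨ trans (+-congˡ (zeroʳ q)) (+-identityʳ _) ⟩
      rowSum (suc y) (λ v → not (v ≡ᵇ suc y)) ∎

    ∑𝓑•-0∷ : ∀ y → ∑𝓑• (0 ∷ suc y ∷ r) ≈ rowSum (suc y) (λ v → v ≡ᵇ suc y)
    ∑𝓑•-0∷ y = begin
      ∑𝓑• (0 ∷ suc y ∷ r)                  ≈⟨ trans (∑𝓑•-gridSum 0 (suc y)) (gridSum-zero (suc y) (bulletPair 0 (suc y))) ⟩
      rowSum (suc y) (bulletPair 0 (suc y) 0)  ≈⟨ rowSum-cong (suc y) _ _ (λ v _ → top v) ⟩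
      rowSum (suc y) (λ v → v ≡ᵇ suc y)        ∎
      where
      top : ∀ v → bulletPair 0 (suc y) 0 v ≡ (v ≡ᵇ suc y)
      top zero    = ∧-zeroʳ (pairRule 0 (suc y) 0 0)
      top (suc v) rewrite ∨-zeroʳ (not (v ≡ᵇ y)) = ∨-identityʳ (v ≡ᵇ y)

    ∑𝓑•-suc∷ : ∀ x y → ∑𝓑• (suc x ∷ y ∷ r) ≈ q * ∑𝓑 (x ∷ y ∷ r)
    ∑𝓑•-suc∷ x y = begin
      ∑𝓑• (suc x ∷ y ∷ r)
        ≈⟨ trans (∑𝓑•-gridSum (suc x) y) (gridSum-suc x y (bulletPair (suc x) y)) ⟩
      rowSum y (bulletPair (suc x) y 0) + q * gridSum x y (λ u v → pairRule x y u v ∧ true)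
        ≈⟨ +-cong (rowSum-false y (bulletPair (suc x) y 0) (λ v → ∧-zeroʳ _)) (*-congˡ (sym (∑𝓑-gridSum x y))) ⟩
      0# + q * ∑𝓑 (x ∷ y ∷ r)
        ≈⟨ +-identityˡ _ ⟩
      q * ∑𝓑 (x ∷ y ∷ r) ∎

    ∑𝓑-partition : ∀ x y → ∑𝓑 (x ∷ suc y ∷ r) ≈ ∑𝓑• (x ∷ suc y ∷ r) + ∑𝓑∘ (x ∷ suc y ∷ r)
    ∑𝓑-partition zero    y = begin
      ∑𝓑 (0 ∷ suc y ∷ r)
        ≈⟨ trans (∑𝓑-gridSum 0 (suc y)) (gridSum-zero (suc y) (λ u v → pairRule 0 (suc y) u v ∧ true)) ⟩
      rowSum (suc y) (λ v → pairRule 0 (suc y) 0 v ∧ true)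
        ≈⟨ rowSum-cong (suc y) (λ v → pairRule 0 (suc y) 0 v ∧ true) _ (λ v _ → ≡.trans (∧-identityʳ _) (∨-zeroʳ _)) ⟩
      rowSum (suc y) (λ _ → true)
        ≈⟨ rowSum-partition (suc y) (λ v → v ≡ᵇ suc y) ⟨
      rowSum (suc y) (λ v → v ≡ᵇ suc y) + rowSum (suc y) (λ v → not (v ≡ᵇ suc y))
        ≈⟨ +-cong (∑𝓑•-0∷ y) (∑𝓑∘-∷∷ 0 y) ⟨
      ∑𝓑• (0 ∷ suc y ∷ r) + ∑𝓑∘ (0 ∷ suc y ∷ r) ∎
    ∑𝓑-partition (suc x) y = begin
      ∑𝓑 (suc x ∷ suc y ∷ r)
        ≈⟨ trans (∑𝓑-gridSum (suc x) (suc y)) (gridSum-suc x (suc y) (λ u v → pairRule (suc x) (suc y) u v ∧ true)) ⟩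
      rowSum (suc y) (λ v → pairRule (suc x) (suc y) 0 v ∧ true) + q * gridSum x (suc y) (λ u v → pairRule x (suc y) u v ∧ true)
        ≈⟨ +-cong (rowSum-cong (suc y) (λ v → pairRule (suc x) (suc y) 0 v ∧ true) _ (λ v _ → ≡.trans (∧-identityʳ _) (∨-identityʳ _)))
                  (*-congˡ (sym (∑𝓑-gridSum x (suc y)))) ⟩
      rowSum (suc y) (λ v → not (v ≡ᵇ suc y)) + q * ∑𝓑 (x ∷ suc y ∷ r)
        ≈⟨ +-cong (∑𝓑∘-∷∷ (suc x) y) (∑𝓑•-suc∷ x (suc y)) ⟨
      ∑𝓑∘ (suc x ∷ suc y ∷ r) + ∑𝓑• (suc x ∷ suc y ∷ r)
        ≈⟨ +-comm _ _ ⟩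
      ∑𝓑• (suc x ∷ suc y ∷ r) + ∑𝓑∘ (suc x ∷ suc y ∷ r) ∎

    TailInvariant : Set
    TailInvariant = tailSum r false ≈ m11 (wordR q r) × q * tailSum r true ≈ q * m11 (wordR q r) + m21 (wordR q r)

  m11-⊗-assoc : ∀ M P N → m11 ((M ⊗ P) ⊗ N) ≈ m11 M * m11 (P ⊗ N) + m12 M * m21 (P ⊗ N)
  m11-⊗-assoc M P N = solve 8 (λ a b p₁₁ p₁₂ p₂₁ p₂₂ n₁ n₂ →
      (a :* p₁₁ :+ b :* p₂₁) :* n₁ :+ (a :* p₁₂ :+ b :* p₂₂) :* n₂
      := a :* (p₁₁ :* n₁ :+ p₁₂ :* n₂) :+ b :* (p₂₁ :* n₁ :+ p₂₂ :* n₂))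
    refl (m11 M) (m12 M) (m11 P) (m12 P) (m21 P) (m22 P) (m11 N) (m21 N)

  m21-⊗-assoc : ∀ M P N → m21 ((M ⊗ P) ⊗ N) ≈ m21 M * m11 (P ⊗ N) + m22 M * m21 (P ⊗ N)
  m21-⊗-assoc M P N = solve 8 (λ c d p₁₁ p₁₂ p₂₁ p₂₂ n₁ n₂ →
      (c :* p₁₁ :+ d :* p₂₁) :* n₁ :+ (c :* p₁₂ :+ d :* p₂₂) :* n₂
      := c :* (p₁₁ :* n₁ :+ p₁₂ :* n₂) :+ d :* (p₂₁ :* n₁ :+ p₂₂ :* n₂))
    refl (m21 M) (m22 M) (m11 P) (m12 P) (m21 P) (m22 P) (m11 N) (m21 N)

  m11-I₂-⊗ : ∀ N → m11 (I₂ ⊗ N) ≈ m11 N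
  m11-I₂-⊗ N = trans (+-cong (*-identityˡ _) (zeroˡ _)) (+-identityʳ _)

  m21-I₂-⊗ : ∀ N → m21 (I₂ ⊗ N) ≈ m21 N
  m21-I₂-⊗ N = trans (+-cong (zeroˡ _) (*-identityˡ _)) (+-identityˡ _)

  wordR-m11-suc : ∀ x ys → m11 (wordR q (suc x ∷ ys)) ≈ q * m11 (wordR q (x ∷ ys)) + m21 (wordR q (x ∷ ys))
  wordR-m11-suc x ys = trans (m11-⊗-assoc (Rq q) (matPow (Rq q) x) (wordL q ys)) (+-congˡ (*-identityˡ _))

  wordR-m21 : ∀ x ys → m21 (wordR q (x ∷ ys)) ≈ m21 (wordL q ys)
  wordR-m21 zero    ys = m21-I₂-⊗ (wordL q ys)
  wordR-m21 (suc x) ys = begin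
    m21 (wordR q (suc x ∷ ys))                                 ≈⟨ m21-⊗-assoc (Rq q) (matPow (Rq q) x) (wordL q ys) ⟩
    0# * m11 (wordR q (x ∷ ys)) + 1# * m21 (wordR q (x ∷ ys))  ≈⟨ trans (+-cong (zeroˡ _) (*-identityˡ _)) (+-identityˡ _) ⟩
    m21 (wordR q (x ∷ ys))                                     ≈⟨ wordR-m21 x ys ⟩
    m21 (wordL q ys)                                           ∎

  Lq-pow-m11 : ∀ n N → m11 (matPow (Lq q) n ⊗ N) ≈ pow q n * m11 N
  Lq-pow-m11 zero    N = trans (m11-I₂-⊗ N) (sym (*-identityˡ _))
  Lq-pow-m11 (suc n) N = begin
    m11 ((Lq q ⊗ matPow (Lq q) n) ⊗ N)                              ≈⟨ m11-⊗-assoc (Lq q) (matPow (Lq q) n) N ⟩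
    q * m11 (matPow (Lq q) n ⊗ N) + 0# * m21 (matPow (Lq q) n ⊗ N)  ≈⟨ trans (+-congˡ (zeroˡ _)) (+-identityʳ _) ⟩
    q * m11 (matPow (Lq q) n ⊗ N)                                   ≈⟨ *-congˡ (Lq-pow-m11 n N) ⟩
    q * (pow q n * m11 N)                                           ≈⟨ *-assoc q (pow q n) (m11 N) ⟨
    pow q (suc n) * m11 N                                           ∎

  Lq-pow-m21 : ∀ n N → m21 (matPow (Lq q) n ⊗ N) ≈ q * [ n ]q * m11 N + m21 N
  Lq-pow-m21 zero    N = trans (m21-I₂-⊗ N) (solve 3 (λ q a b → b := q :* con 0 :* a :+ b) refl q (m11 N) (m21 N))
  Lq-pow-m21 (suc n) N = begin
    m21 ((Lq q ⊗ matPow (Lq q) n) ⊗ N)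
      ≈⟨ m21-⊗-assoc (Lq q) (matPow (Lq q) n) N ⟩
    q * m11 (matPow (Lq q) n ⊗ N) + 1# * m21 (matPow (Lq q) n ⊗ N)
      ≈⟨ +-cong (*-congˡ (Lq-pow-m11 n N)) (trans (*-identityˡ _) (Lq-pow-m21 n N)) ⟩
    q * (pow q n * m11 N) + (q * [ n ]q * m11 N + m21 N)
      ≈⟨ solve 5 (λ q p g a b → q :* (p :* a) :+ (q :* g :* a :+ b) := q :* (g :+ p) :* a :+ b) refl q (pow q n) [ n ]q (m11 N) (m21 N) ⟩
    q * ([ n ]q + pow q n) * m11 N + m21 N
      ≈⟨ +-congʳ (*-congʳ (*-congˡ ([suc]q-snoc n))) ⟨
    q * [ suc n ]q * m11 N + m21 N ∎

  MatrixFormula : List ℕ → Set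
  MatrixFormula a = ∑𝓑• a ≈ m11 (wordR q a) × q * ∑𝓑∘ a ≈ m21 (wordR q a)

  matrixFormula-∷∷ : ∀ r → TailInvariant r → ∀ x y → MatrixFormula (x ∷ suc y ∷ r)
  matrixFormula-∷∷ r (k₀≈A , qk₁≈qA+B) x y = bulletPart x , circPart x
    where
    A = m11 (wordR q r)
    B = m21 (wordR q r)

    circPart : ∀ x → q * ∑𝓑∘ (x ∷ suc y ∷ r) ≈ m21 (wordR q (x ∷ suc y ∷ r))
    circPart x = begin
      q * ∑𝓑∘ (x ∷ suc y ∷ r)
        ≈⟨ *-congˡ (trans (∑𝓑∘-∷∷ r x y) (rowSum-≢ᵇ r y)) ⟩
      q * (tailSum r true + q * [ y ]q * tailSum r false)
        ≈⟨ trans (distribˡ q _ _) (+-cong qk₁≈qA+B (*-congˡ (*-congˡ k₀≈A))) ⟩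
      (q * A + B) + q * (q * [ y ]q * A)
        ≈⟨ solve 4 (λ q g a b → (q :* a :+ b) :+ q :* (q :* g :* a) := q :* (con 1 :+ q :* g) :* a :+ b) refl q [ y ]q A B ⟩
      q * [ suc y ]q * A + B
        ≈⟨ Lq-pow-m21 (suc y) (wordR q r) ⟨
      m21 (wordL q (suc y ∷ r))
        ≈⟨ wordR-m21 x (suc y ∷ r) ⟨
      m21 (wordR q (x ∷ suc y ∷ r)) ∎

    bulletPart : ∀ x → ∑𝓑• (x ∷ suc y ∷ r) ≈ m11 (wordR q (x ∷ suc y ∷ r))
    bulletPart zero = begin
      ∑𝓑• (0 ∷ suc y ∷ r)                ≈⟨ trans (∑𝓑•-0∷ r y) (rowSum-≡ᵇ r y) ⟩
      pow q (suc y) * tailSum r false     ≈⟨ *-congˡ k₀≈A ⟩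
      pow q (suc y) * A                   ≈⟨ Lq-pow-m11 (suc y) (wordR q r) ⟨
      m11 (wordL q (suc y ∷ r))           ≈⟨ m11-I₂-⊗ (wordL q (suc y ∷ r)) ⟨
      m11 (wordR q (0 ∷ suc y ∷ r))       ∎
    bulletPart (suc x) = begin
      ∑𝓑• (suc x ∷ suc y ∷ r)                              ≈⟨ ∑𝓑•-suc∷ r x (suc y) ⟩
      q * ∑𝓑 (x ∷ suc y ∷ r)                               ≈⟨ *-congˡ (∑𝓑-partition r x y) ⟩
      q * (∑𝓑• (x ∷ suc y ∷ r) + ∑𝓑∘ (x ∷ suc y ∷ r))      ≈⟨ distribˡ q _ _ ⟩
      q * ∑𝓑• (x ∷ suc y ∷ r) + q * ∑𝓑∘ (x ∷ suc y ∷ r)    ≈⟨ +-cong (*-congˡ (bulletPart x)) (circPart x) ⟩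
      q * m11 (wordR q (x ∷ suc y ∷ r)) + m21 (wordR q (x ∷ suc y ∷ r)) ≈⟨ wordR-m11-suc x (suc y ∷ r) ⟨
      m11 (wordR q (suc x ∷ suc y ∷ r))                    ∎

  tailInvariant-[] : TailInvariant []
  tailInvariant-[] = solve 0 (con 1 :* con 1 :+ con 0 := con 1) refl
                   , solve 1 (λ q → q :* (con 1 :* con 1 :+ con 0) := q :* con 1 :+ con 0) refl q

  tailInvariant-∷∷ : ∀ x y r → MatrixFormula (suc x ∷ suc y ∷ r) → TailInvariant (suc x ∷ suc y ∷ r)
  tailInvariant-∷∷ x y r (bullet≈ , circ≈) = trans (admissibleSum-cong a linked-false) bullet≈ , (begin
    q * tailSum a true              ≈⟨ *-congˡ (admissibleSum-cong a (λ c → ∨-zeroʳ _)) ⟩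
    q * ∑𝓑 a                        ≈⟨ *-congˡ (∑𝓑-partition r (suc x) y) ⟩
    q * (∑𝓑• a + ∑𝓑∘ a)             ≈⟨ distribˡ q _ _ ⟩
    q * ∑𝓑• a + q * ∑𝓑∘ a           ≈⟨ +-cong (*-congˡ bullet≈) circ≈ ⟩
    q * m11 (wordR q a) + m21 (wordR q a) ∎)
    where
    a = suc x ∷ suc y ∷ r
    linked-false : ∀ c → linked a c false ≡ bullet a c
    linked-false []          = ≡.refl
    linked-false (zero  ∷ _) = ≡.refl
    linked-false (suc _ ∷ _) = ≡.refl

  tailInvariant : ∀ {r} → PositivePairs r → TailInvariant r
  tailInvariant []               = tailInvariant-[]
  tailInvariant (pair x y {r} p) = tailInvariant-∷∷ x y r (matrixFormula-∷∷ r (tailInvariant p) (suc x) y)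

  matrixFormula : ∀ {a} → EvenExpansion a → MatrixFormula a
  matrixFormula (expansion x y {r} p) = matrixFormula-∷∷ r (tailInvariant p) x y

halve : ∀ {n} m → suc (suc n) ≡ 2 N.* suc m → n ≡ 2 N.* m
halve m eq = suc-injective (suc-injective (≡.trans eq (*-suc 2 m)))

positivePairs : ∀ m r → length r ≡ 2 N.* m → (∀ i → i < length r → 1 ≤ at r i) → PositivePairs r
positivePairs zero    []          _   _   = []
positivePairs (suc m) (x ∷ [])    len _   with ≡.trans len (*-suc 2 m)
... | ()
positivePairs (suc m) (x ∷ y ∷ r) len pos with pos 0 (s≤s z≤n) | pos 1 (s≤s (s≤s z≤n))
... | s≤s _ | s≤s _ = pair _ _ (positivePairs m r (halve m len) (λ i i<n → pos (2 N.+ i) (s≤s (s≤s i<n))))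

evenExpansion : ∀ ℓ a → 1 ≤ ℓ → length a ≡ 2 N.* ℓ → (∀ i → 1 ≤ i → i < length a → 1 ≤ at a i) → EvenExpansion a
evenExpansion (suc m) (x ∷ [])    _ len _   with ≡.trans len (*-suc 2 m)
... | ()
evenExpansion (suc m) (x ∷ y ∷ r) _ len pos with pos 1 (s≤s z≤n) (s≤s (s≤s z≤n))
... | s≤s _ = expansion x _ (positivePairs m r (halve m len) (λ i i<n → pos (2 N.+ i) (s≤s z≤n) (s≤s (s≤s i<n))))

theoremB : (S : CommutativeSemiring 0ℓ 0ℓ) (q : CommutativeSemiring.Carrier S)
    (ℓ : ℕ) (a : List ℕ) → 1 ≤ ℓ → length a ≡ 2 N.* ℓ →
    (∀ i → 1 ≤ i → i < length a → 1 ≤ at a i) →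
    let open CommutativeSemiring S
        open Poly S
        M = wordR q a
    in (genSum q (𝓑• a) ≈ m11 M) × (q * genSum q (𝓑∘ a) ≈ m21 M)
theoremB S q ℓ a 1≤ℓ len pos =
    trans (genSum-filter-𝓑 a (bullet a)) (proj₁ formula)
  , trans (*-congˡ (genSum-filter-𝓑 a (circ a))) (proj₂ formula)
  where
  open CommutativeSemiring S
  open GeneratingSums S q
  formula : MatrixFormula a
  formula = matrixFormula (evenExpansion ℓ a 1≤ℓ len pos)
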